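{- For every D3-reducible graph $G$ and every edge $uv$ of $G$, the graph $G-uv$ obtained by deleting the edge $uv$ is not 3-vertex-connected.
   Context: All graphs are finite and simple. The D3 reductions are the following two operations on a graph $G$. (D3a) Let $p,q,r$ be three vertices of degree three that induce a triangle in $G$ and whose neighbors outside $\{p,q,r\}$ are three distinct vertices; replace $p,q,r$ by a single new vertex adjacent to exactly those three outside neighbors. (D3b) Let $p,q,r$ be three vertices of degree three that induce a path with middle vertex $q$, and suppose there is a single vertex $s$ adjacent to all three of $p,q,r$; delete $q$ and add a new edge from $p$ to $r$. A graph is D3-reducible if it can be transformed into a graph isomorphic to $K_4$ by a finite sequence of D3 reductions. -}

module Defs where

open import Data.Nat using (ℕ; suc; _<_)
open import Data.Bool using (Bool; true; false; if_then_else_; _∧_; _∨_; not)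
open import Data.Fin using (Fin; _≟_)
open import Data.Fin.Subset using (Subset; _∉_; ∣_∣)
open import Data.List using (map; allFin)
open import Data.Nat.ListAction using (sum)
open import Data.Product using (Σ; ∃; _×_; _,_)
open import Data.Sum using (_⊎_)
open import Relation.Nullary using (¬_)
open import Relation.Nullary.Decidable using (⌊_⌋)
open import Relation.Binary.PropositionalEquality using (_≡_; _≢_)

Graph : ℕ → Set
Graph n = Fin n → Fin n → Bool

record IsSimple {n : ℕ} (G : Graph n) : Set where
  field
    sym   : ∀ x y → G x y ≡ G y x
    loopless : ∀ x → G x x ≡ false

deg : ∀ {n} → Graph n → Fin n → ℕ
deg {n} G u = sum (map (λ v → if G u v then 1 else 0) (allFin n))

_==_ : ∀ {n} → Fin n → Fin n → Bool
x == y = ⌊ x ≟ y ⌋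

In3 : ∀ {n} → Fin n → Fin n → Fin n → Fin n → Set
In3 p q r x = x ≡ p ⊎ x ≡ q ⊎ x ≡ r

-- D3a: H (on m vertices) is obtained from G (on n vertices) by contracting a
-- triangle p,q,r of degree-3 vertices with three distinct outside neighbours a,b,c
-- into a single new vertex.  σ sends p,q,r to the new vertex w = σ p and is a
-- bijection from V(G) ∖ {p,q,r} onto V(H) ∖ {w}.
record D3a {n m : ℕ} (G : Graph n) (H : Graph m) : Set where
  field
    p q r a b c : Fin n
    p≢q : p ≢ q
    q≢r : q ≢ r
    p≢r : p ≢ r
    degp : deg G p ≡ 3
    degq : deg G q ≡ 3
    degr : deg G r ≡ 3
    pq : G p q ≡ true
    qr : G q r ≡ true
    pr : G p r ≡ true
    pa : G p a ≡ true
    qb : G q b ≡ true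
    rc : G r c ≡ true
    a∉ : ¬ In3 p q r a
    b∉ : ¬ In3 p q r b
    c∉ : ¬ In3 p q r c
    a≢b : a ≢ b
    b≢c : b ≢ c
    a≢c : a ≢ c
    σ : Fin n → Fin m
    σq : σ q ≡ σ p
    σr : σ r ≡ σ p
    σ-out : ∀ x → ¬ In3 p q r x → σ x ≢ σ p
    σ-inj : ∀ x y → ¬ In3 p q r x → ¬ In3 p q r y → σ x ≡ σ y → x ≡ y
    σ-surj : ∀ z → ∃ λ x → σ x ≡ z
    adj-out : ∀ x y → ¬ In3 p q r x → ¬ In3 p q r y → H (σ x) (σ y) ≡ G x y
    adj-new : ∀ x → ¬ In3 p q r x → H (σ p) (σ x) ≡ ((x == a) ∨ (x == b) ∨ (x == c))

-- D3b: p,q,r of degree three induce a path with middle vertex q, s is adjacent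
-- to all of p,q,r; H is obtained by deleting q and adding the edge pr.
-- σ is a bijection from V(H) onto V(G) ∖ {q}.
record D3b {n m : ℕ} (G : Graph n) (H : Graph m) : Set where
  field
    p q r s : Fin n
    p≢q : p ≢ q
    q≢r : q ≢ r
    p≢r : p ≢ r
    degp : deg G p ≡ 3
    degq : deg G q ≡ 3
    degr : deg G r ≡ 3
    pq : G p q ≡ true
    qr : G q r ≡ true
    pr : G p r ≡ false
    sp : G s p ≡ true
    sq : G s q ≡ true
    sr : G s r ≡ true
    σ : Fin m → Fin n
    σ-inj : ∀ x y → σ x ≡ σ y → x ≡ y
    σ≢q : ∀ x → σ x ≢ q
    σ-surj : ∀ y → y ≢ q → ∃ λ x → σ x ≡ y
    adj : ∀ x y → H x y ≡ (G (σ x) (σ y) ∨ ((σ x == p) ∧ (σ y == r)) ∨ ((σ x == r) ∧ (σ y == p)))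

IsoK4 : ∀ {n} → Graph n → Set
IsoK4 {n} G = Σ (Fin n → Fin 4) λ f →
  (∀ x y → f x ≡ f y → x ≡ y) × (∀ z → ∃ λ x → f x ≡ z) ×
  (∀ x y → G x y ≡ not (f x == f y))

data D3Step {n m : ℕ} (G : Graph n) (H : Graph m) : Set where
  stepA : D3a G H → D3Step G H
  stepB : D3b G H → D3Step G H

data D3Reducible : {n : ℕ} → Graph n → Set where
  done : ∀ {n} {G : Graph n} → IsoK4 G → D3Reducible G
  step : ∀ {n m} {G : Graph n} {H : Graph m} →
         IsSimple H → D3Step G H → D3Reducible H → D3Reducible G

deleteEdge : ∀ {n} → Graph n → Fin n → Fin n → Graph n
deleteEdge G u v x y = G x y ∧ not (((x == u) ∧ (y == v)) ∨ ((x == v) ∧ (y == u)))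

data Reach {n} (G : Graph n) (S : Subset n) : Fin n → Fin n → Set where
  here : ∀ {x} → Reach G S x x
  there : ∀ {x y z} → G x z ≡ true → z ∉ S → Reach G S z y → Reach G S x y

VertexConnected : ℕ → ∀ {n} → Graph n → Set
VertexConnected k {n} G = (k < n) ×
  (∀ (X : Subset n) → ∣ X ∣ < k → ∀ x y → x ∉ X → y ∉ X → Reach G X x y)

module Submission where

-- Call an edge uv of G *separable* if there are two vertices α, β, both different
-- from u and v, and a 2-colouring of the vertices that is constant along every edge
-- of G − uv avoiding {α, β} while giving u and v different colours.  Then {α, β}
-- separates u from v in G − uv, so G − uv is not 3-connected.  It therefore suffices
-- to show that every edge of a D3-reducible graph is separable, by induction on the
-- reduction sequence:
--   * an edge at a vertex of degree three is separated by the two other neighbours of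
--     that vertex; this handles K₄ and every edge touching the reduced vertices;
--   * every other edge of G is an edge of the reduced graph H, and a separation of it
--     in H pulls back to G: for D3a the contracted vertex is re-expanded into the
--     triangle (if it was a separator vertex it is replaced by a suitable triangle
--     vertex), for D3b the deleted vertex q takes the colour of its neighbours.

open import Defs
open import Data.Nat using (ℕ)
open import Data.Bool using (true)
open import Data.Fin using (Fin)
open import Relation.Nullary using (¬_)
open import Relation.Binary.PropositionalEquality using (_≡_)
open import Data.Nat using (zero; suc; _+_; _≤_; _<_; z≤n; s≤s)
open import Data.Nat.Properties using (+-suc; +-monoʳ-≤; ≤-trans; ≤-reflexive; n≤1+n; suc-injective)
open import Data.Nat.ListAction using (sum)
open import Data.Bool using (Bool; false; if_then_else_; _∧_; _∨_; not)
open import Data.Bool.Properties using (∨-comm; ∧-identityʳ; ∧-zeroʳ)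
open import Data.Empty using (⊥-elim)
open import Data.Unit using (⊤; tt)
open import Data.Fin using (zero; suc; _≟_; punchIn; punchOut)
open import Data.Fin.Properties using (punchIn-injective; punchIn-punchOut; punchInᵢ≢i)
  renaming (suc-injective to Fin-suc-injective)
open import Data.Fin.Subset using (Subset; _∉_; ∣_∣; _∪_; ⁅_⁆)
open import Data.Fin.Subset.Properties using (x∈p∪q⁻; x∈p∪q⁺; x∈⁅y⁆⇒x≡y; x∈⁅x⁆; ∣⁅x⁆∣≡1)
open import Data.List using (tabulate)
open import Data.List.Properties using (map-tabulate)
open import Data.Vec using ([]; _∷_)
open import Data.Product using (∃; _×_; _,_; proj₁; proj₂)
open import Data.Sum using (_⊎_; inj₁; inj₂)
open import Function using (_∘_; id)
open import Function.Bundles using (mk⇔)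
open import Relation.Nullary using (Dec; yes; no; does)
open import Relation.Nullary.Decidable using (isYes≗does; dec-true; dec-false; does-⇔; ⌊⌋-map′; _⊎-dec_)
open import Relation.Binary.PropositionalEquality
  using (_≢_; refl; sym; trans; cong; cong₂; subst; subst₂; module ≡-Reasoning)

==-true : ∀ {n} {x y : Fin n} → x ≡ y → (x == y) ≡ true
==-true {x = x} {y} x≡y = trans (isYes≗does (x ≟ y)) (dec-true (x ≟ y) x≡y)

==-false : ∀ {n} {x y : Fin n} → x ≢ y → (x == y) ≡ false
==-false {x = x} {y} x≢y = trans (isYes≗does (x ≟ y)) (dec-false (x ≟ y) x≢y)

==-rename : ∀ {n m} (f : Fin n → Fin m) {x y : Fin n} →
  (f x ≡ f y → x ≡ y) → (f x == f y) ≡ (x == y)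
==-rename f {x} {y} inj = begin
  (f x == f y)               ≡⟨ isYes≗does (f x ≟ f y) ⟩
  does (f x ≟ f y)           ≡⟨ does-⇔ (mk⇔ inj (cong f)) (f x ≟ f y) (x ≟ y) ⟩
  does (x ≟ y)               ≡⟨ sym (isYes≗does (x ≟ y)) ⟩
  (x == y)                   ∎
  where open ≡-Reasoning

suc-== : ∀ {n} (x y : Fin n) → (suc x == suc y) ≡ (x == y)
suc-== x y = ⌊⌋-map′ (cong suc) Fin-suc-injective (x ≟ y)

∧-true : ∀ {a b : Bool} → a ∧ b ≡ true → a ≡ true × b ≡ true
∧-true {true} {true} _ = refl , refl

t≢f : true ≢ false
t≢f ()

module _ {n} {G : Graph n} (sim : IsSimple G) where

  adjacent⇒≢ : ∀ {x y} → G x y ≡ true → x ≢ y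
  adjacent⇒≢ {x} xy refl = t≢f (trans (sym xy) (IsSimple.loopless sim x))

  adjacent-sym : ∀ {x y} → G x y ≡ true → G y x ≡ true
  adjacent-sym {x} {y} xy = trans (IsSimple.sym sim y x) xy

In3? : ∀ {n} (a b c z : Fin n) → Dec (In3 a b c z)
In3? a b c z = (z ≟ a) ⊎-dec (z ≟ b) ⊎-dec (z ≟ c)

In3-swap : ∀ {n} {a b c z : Fin n} → In3 a b c z → In3 b a c z
In3-swap (inj₁ e) = inj₂ (inj₁ e)
In3-swap (inj₂ (inj₁ e)) = inj₁ e
In3-swap (inj₂ (inj₂ e)) = inj₂ (inj₂ e)

In3-rotate : ∀ {n} {a b c z : Fin n} → In3 a b c z → In3 c a b z
In3-rotate (inj₁ e) = inj₂ (inj₁ e)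
In3-rotate (inj₂ (inj₁ e)) = inj₂ (inj₂ e)
In3-rotate (inj₂ (inj₂ e)) = inj₁ e

avoid-two : ∀ {n} {a b c : Fin n} → a ≢ b → a ≢ c → b ≢ c →
  ∀ α β → ∃ λ t → In3 a b c t × t ≢ α × t ≢ β
avoid-two {a = a} {b} {c} a≢b a≢c b≢c α β with a ≟ α | a ≟ β
... | no a≢α | no a≢β = a , inj₁ refl , a≢α , a≢β
... | yes refl | _ with b ≟ β
...   | no b≢β = b , inj₂ (inj₁ refl) , a≢b ∘ sym , b≢β
...   | yes refl = c , inj₂ (inj₂ refl) , a≢c ∘ sym , b≢c ∘ sym
avoid-two {a = a} {b} {c} a≢b a≢c b≢c α β | no _ | yes refl with b ≟ α
...   | no b≢α = b , inj₂ (inj₁ refl) , b≢α , a≢b ∘ sym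
...   | yes refl = c , inj₂ (inj₂ refl) , b≢c ∘ sym , a≢c ∘ sym

deleteEdge-⊆ : ∀ {n} (G : Graph n) {u v x y} → deleteEdge G u v x y ≡ true → G x y ≡ true
deleteEdge-⊆ G = proj₁ ∘ ∧-true

deleteEdge-uv : ∀ {n} (G : Graph n) u v → deleteEdge G u v u v ≡ false
deleteEdge-uv G u v rewrite ==-true (refl {x = u}) | ==-true (refl {x = v}) = ∧-zeroʳ (G u v)

deleteEdge-comm : ∀ {n} (G : Graph n) u v x y → deleteEdge G u v x y ≡ deleteEdge G v u x y
deleteEdge-comm G u v x y =
  cong (λ b → G x y ∧ not b) (∨-comm ((x == u) ∧ (y == v)) ((x == v) ∧ (y == u)))

deleteEdge-from-u : ∀ {n} (G : Graph n) {u v y} → deleteEdge G u v u y ≡ true → y ≢ v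
deleteEdge-from-u G {u} {v} e refl = t≢f (trans (sym e) (deleteEdge-uv G u v))

deleteEdge-into-u : ∀ {n} (G : Graph n) {u v x} → deleteEdge G u v x u ≡ true → x ≢ v
deleteEdge-into-u G {u} {v} e refl =
  t≢f (trans (sym e) (trans (deleteEdge-comm G u v v u) (deleteEdge-uv G v u)))

deleteEdge-away : ∀ {n} (G : Graph n) {u v x} y → x ≢ u → x ≢ v → deleteEdge G u v x y ≡ G x y
deleteEdge-away G {x = x} y x≢u x≢v rewrite ==-false x≢u | ==-false x≢v = ∧-identityʳ (G x y)

deleteEdge-mono : ∀ {n} (G K : Graph n) {u v x y} → (G x y ≡ true → K x y ≡ true) →
  deleteEdge G u v x y ≡ true → deleteEdge K u v x y ≡ true
deleteEdge-mono G K G⇒K del rewrite G⇒K (proj₁ (∧-true del)) = proj₂ (∧-true del)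

deleteEdge-rename : ∀ {n m} (K : Graph m) (f : Fin n → Fin m) {u v x y} →
  (f x ≡ f u → x ≡ u) → (f y ≡ f v → y ≡ v) → (f x ≡ f v → x ≡ v) → (f y ≡ f u → y ≡ u) →
  deleteEdge K (f u) (f v) (f x) (f y) ≡ deleteEdge (λ a b → K (f a) (f b)) u v x y
deleteEdge-rename K f xu yv xv yu
  rewrite ==-rename f xu | ==-rename f yv | ==-rename f xv | ==-rename f yu = refl

record Separation {n} (G : Graph n) (u v : Fin n) : Set where
  field
    α β : Fin n
    colour : Fin n → Bool
    u≢α : u ≢ α
    u≢β : u ≢ β
    v≢α : v ≢ α
    v≢β : v ≢ β
    colour-u : colour u ≡ true
    colour-v : colour v ≡ false
    respects : ∀ x y → x ≢ α → x ≢ β → y ≢ α → y ≢ β →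
      deleteEdge G u v x y ≡ true → colour x ≡ colour y

Separable : ∀ {n} → Graph n → Set
Separable {n} G = ∀ (u v : Fin n) → G u v ≡ true → Separation G u v

separation-flip : ∀ {n} {G : Graph n} {u v} → Separation G v u → Separation G u v
separation-flip {G = G} {u} {v} s = record
  { α = α ; β = β ; colour = not ∘ colour
  ; u≢α = v≢α ; u≢β = v≢β ; v≢α = u≢α ; v≢β = u≢β
  ; colour-u = cong not colour-v ; colour-v = cong not colour-u
  ; respects = λ x y x≢α x≢β y≢α y≢β e →
      cong not (respects x y x≢α x≢β y≢α y≢β (trans (deleteEdge-comm G v u x y) e)) }
  where open Separation s

∣p∪q∣≤∣p∣+∣q∣ : ∀ {n} (p q : Subset n) → ∣ p ∪ q ∣ ≤ ∣ p ∣ + ∣ q ∣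
∣p∪q∣≤∣p∣+∣q∣ [] [] = z≤n
∣p∪q∣≤∣p∣+∣q∣ (true ∷ p) (true ∷ q) =
  s≤s (≤-trans (∣p∪q∣≤∣p∣+∣q∣ p q) (+-monoʳ-≤ ∣ p ∣ (n≤1+n ∣ q ∣)))
∣p∪q∣≤∣p∣+∣q∣ (true ∷ p) (false ∷ q) = s≤s (∣p∪q∣≤∣p∣+∣q∣ p q)
∣p∪q∣≤∣p∣+∣q∣ (false ∷ p) (true ∷ q) =
  ≤-trans (s≤s (∣p∪q∣≤∣p∣+∣q∣ p q)) (≤-reflexive (sym (+-suc ∣ p ∣ ∣ q ∣)))
∣p∪q∣≤∣p∣+∣q∣ (false ∷ p) (false ∷ q) = ∣p∪q∣≤∣p∣+∣q∣ p q

pair : ∀ {n} → Fin n → Fin n → Subset n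
pair α β = ⁅ α ⁆ ∪ ⁅ β ⁆

∣pair∣<3 : ∀ {n} (α β : Fin n) → ∣ pair α β ∣ < 3
∣pair∣<3 α β = s≤s (subst (∣ pair α β ∣ ≤_) (cong₂ _+_ (∣⁅x⁆∣≡1 α) (∣⁅x⁆∣≡1 β))
                           (∣p∪q∣≤∣p∣+∣q∣ ⁅ α ⁆ ⁅ β ⁆))

∉pair : ∀ {n} {α β x : Fin n} → x ≢ α → x ≢ β → x ∉ pair α β
∉pair {α = α} {β} x≢α x≢β x∈ with x∈p∪q⁻ ⁅ α ⁆ ⁅ β ⁆ x∈
... | inj₁ x∈α = x≢α (x∈⁅y⁆⇒x≡y α x∈α)
... | inj₂ x∈β = x≢β (x∈⁅y⁆⇒x≡y β x∈β)

∉pair⇒≢ : ∀ {n} {α β x : Fin n} → x ∉ pair α β → x ≢ α × x ≢ β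
∉pair⇒≢ x∉ = (λ { refl → x∉ (x∈p∪q⁺ (inj₁ (x∈⁅x⁆ _))) })
            , (λ { refl → x∉ (x∈p∪q⁺ (inj₂ (x∈⁅x⁆ _))) })

-- A separation makes G − uv disconnected after removing {α, β}: the colouring is
-- constant along walks avoiding {α, β}, but u and v have different colours.
separation⇒¬3-connected : ∀ {n} {G : Graph n} {u v} →
  Separation G u v → ¬ VertexConnected 3 (deleteEdge G u v)
separation⇒¬3-connected {G = G} {u} {v} s (_ , connected) =
  t≢f (trans (sym colour-u) (trans (constant-on-walks u∉ (connected X (∣pair∣<3 α β) u v u∉ v∉)) colour-v))
  where
  open Separation s
  X : Subset _
  X = pair α β
  u∉ : u ∉ X
  u∉ = ∉pair u≢α u≢β
  v∉ : v ∉ X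
  v∉ = ∉pair v≢α v≢β
  constant-on-walks : ∀ {x y} → x ∉ X → Reach (deleteEdge G u v) X x y → colour x ≡ colour y
  constant-on-walks x∉ here = refl
  constant-on-walks {x} x∉ (there {z = z} e z∉ walk) =
    let x≢α , x≢β = ∉pair⇒≢ x∉
        z≢α , z≢β = ∉pair⇒≢ z∉
    in trans (respects x z x≢α x≢β z≢α z≢β e) (constant-on-walks z∉ walk)

count : ∀ {n} → (Fin n → Bool) → ℕ
count f = sum (tabulate (λ v → if f v then 1 else 0))

deg≡count : ∀ {n} (G : Graph n) u → deg G u ≡ count (G u)
deg≡count G u = cong sum (map-tabulate id (λ v → if G u v then 1 else 0))

count-cong : ∀ {n} {f g : Fin n → Bool} → (∀ v → f v ≡ g v) → count f ≡ count g
count-cong {zero} f≗g = refl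
count-cong {suc n} f≗g =
  cong₂ (λ b k → (if b then 1 else 0) + k) (f≗g zero) (count-cong (f≗g ∘ suc))

without : ∀ {n} → (Fin n → Bool) → Fin n → Fin n → Bool
without f z v = f v ∧ not (v == z)

without-keep : ∀ {n} (f : Fin n → Bool) z {v} → f v ≡ true → v ≢ z → without f z v ≡ true
without-keep f z fv v≢z rewrite fv | ==-false v≢z = refl

without-true : ∀ {n} (f : Fin n → Bool) z {v} → without f z v ≡ true → f v ≡ true × v ≢ z
without-true f z {v} e = proj₁ (∧-true e) , v≢z
  where
  v≢z : v ≢ z
  v≢z refl = t≢f (trans (sym (proj₂ (∧-true e))) (cong not (==-true {x = z} refl)))

count-without : ∀ {n} (f : Fin n → Bool) → ∀ {z} → f z ≡ true → count f ≡ suc (count (without f z))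
count-without {suc n} f {zero} fz rewrite fz =
  cong suc (count-cong (λ v → sym (∧-identityʳ (f (suc v)))))
count-without {suc n} f {suc z} fz =
  trans (cong ((if f zero then 1 else 0) +_) (count-without (f ∘ suc) fz))
        (trans (+-suc _ _) (cong suc (cong₂ _+_ head tail)))
  where
  head : (if f zero then 1 else 0) ≡ (if f zero ∧ true then 1 else 0)
  head = cong (λ b → if b then 1 else 0) (sym (∧-identityʳ (f zero)))
  tail : count (without (f ∘ suc) z) ≡ count (without f (suc z) ∘ suc)
  tail = count-cong (λ v → cong (λ b → f (suc v) ∧ not b) (sym (suc-== v z)))

count-without₂ : ∀ {n} (f : Fin n → Bool) → ∀ {a b} → f a ≡ true → f b ≡ true → a ≢ b →
  count f ≡ suc (suc (count (without (without f a) b)))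
count-without₂ f {a} fa fb a≢b =
  trans (count-without f fa) (cong suc (count-without (without f a) (without-keep f a fb (a≢b ∘ sym))))

count-witness : ∀ {n} (f : Fin n → Bool) → ∀ {k} → count f ≡ suc k → ∃ λ z → f z ≡ true
count-witness {zero} f ()
count-witness {suc n} f e with f zero in f0
... | true = zero , f0
... | false = let z , fz = count-witness (f ∘ suc) e in suc z , fz

record Cubic {n} (G : Graph n) (u : Fin n) : Set where
  field
    a b c : Fin n
    ua : G u a ≡ true
    ub : G u b ≡ true
    uc : G u c ≡ true
    a≢b : a ≢ b
    a≢c : a ≢ c
    b≢c : b ≢ c
    only : ∀ z → G u z ≡ true → In3 a b c z

module _ {n} (G : Graph n) {u : Fin n} (deg3 : deg G u ≡ 3) where

  degree3-third : ∀ {a b} → G u a ≡ true → G u b ≡ true → a ≢ b →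
    ∃ λ c → G u c ≡ true × c ≢ a × c ≢ b
  degree3-third {a} {b} ua ub a≢b =
    let c , rest-c = count-witness rest one-left
        ua-c , c≢b = without-true (without (G u) a) b rest-c
        uc , c≢a = without-true (G u) a ua-c
    in c , uc , c≢a , c≢b
    where
    rest : Fin n → Bool
    rest = without (without (G u) a) b
    one-left : count rest ≡ 1
    one-left = suc-injective (suc-injective
      (trans (sym (count-without₂ (G u) ua ub a≢b)) (trans (sym (deg≡count G u)) deg3)))

  cubic : ∀ {a b c} → G u a ≡ true → G u b ≡ true → G u c ≡ true →
    a ≢ b → a ≢ c → b ≢ c → Cubic G u
  cubic {a} {b} {c} ua ub uc a≢b a≢c b≢c =
    record { ua = ua ; ub = ub ; uc = uc ; a≢b = a≢b ; a≢c = a≢c ; b≢c = b≢c ; only = only }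
    where
    rest : Fin n → Bool
    rest = without (without (G u) a) b
    in-rest : ∀ {y} → G u y ≡ true → y ≢ a → y ≢ b → rest y ≡ true
    in-rest uy y≢a y≢b = without-keep (without (G u) a) b (without-keep (G u) a uy y≢a) y≢b
    four-neighbours : ∀ {z} → G u z ≡ true → z ≢ a → z ≢ b → z ≢ c →
      ∃ λ k → deg G u ≡ suc (suc (suc (suc k)))
    four-neighbours uz z≢a z≢b z≢c = _ ,
      trans (deg≡count G u) (trans (count-without₂ (G u) ua ub a≢b)
        (cong (2 +_) (count-without₂ rest (in-rest uc (a≢c ∘ sym) (b≢c ∘ sym))
                                                 (in-rest uz z≢a z≢b) (z≢c ∘ sym))))
    only : ∀ z → G u z ≡ true → In3 a b c z
    only z uz with z ≟ a | z ≟ b | z ≟ c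
    ... | yes z≡a | _ | _ = inj₁ z≡a
    ... | no _ | yes z≡b | _ = inj₂ (inj₁ z≡b)
    ... | no _ | no _ | yes z≡c = inj₂ (inj₂ z≡c)
    ... | no z≢a | no z≢b | no z≢c with trans (sym deg3) (proj₂ (four-neighbours uz z≢a z≢b z≢c))
    ...   | ()

  cubic₂ : ∀ {a b} → G u a ≡ true → G u b ≡ true → a ≢ b → Cubic G u
  cubic₂ ua ub a≢b =
    let c , uc , c≢a , c≢b = degree3-third ua ub a≢b
    in cubic ua ub uc a≢b (c≢a ∘ sym) (c≢b ∘ sym)

module _ {n} {G : Graph n} (sim : IsSimple G) where

  -- If every neighbour of u other than v lies in {m₁, m₂}, then {m₁, m₂} separates the
  -- edge uv: colour u alone, since in G − uv every edge at u leads into {m₁, m₂}.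
  separation-at-sparse-endpoint : ∀ {u v m₁ m₂} → G u v ≡ true →
    (∀ y → G u y ≡ true → In3 v m₁ m₂ y) →
    u ≢ m₁ → u ≢ m₂ → v ≢ m₁ → v ≢ m₂ → Separation G u v
  separation-at-sparse-endpoint {u} {v} {m₁} {m₂} uv nbrs u≢m₁ u≢m₂ v≢m₁ v≢m₂ = record
    { α = m₁ ; β = m₂ ; colour = _== u
    ; u≢α = u≢m₁ ; u≢β = u≢m₂ ; v≢α = v≢m₁ ; v≢β = v≢m₂
    ; colour-u = ==-true refl ; colour-v = ==-false (adjacent⇒≢ sim uv ∘ sym)
    ; respects = respects }
    where
    only-v : ∀ {y} → G u y ≡ true → y ≢ m₁ → y ≢ m₂ → y ≡ v
    only-v {y} uy y≢m₁ y≢m₂ with nbrs y uy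
    ... | inj₁ y≡v = y≡v
    ... | inj₂ (inj₁ y≡m₁) = ⊥-elim (y≢m₁ y≡m₁)
    ... | inj₂ (inj₂ y≡m₂) = ⊥-elim (y≢m₂ y≡m₂)
    respects : ∀ x y → x ≢ m₁ → x ≢ m₂ → y ≢ m₁ → y ≢ m₂ →
      deleteEdge G u v x y ≡ true → (x == u) ≡ (y == u)
    respects x y x≢m₁ x≢m₂ y≢m₁ y≢m₂ e = decide (x ≟ u) (y ≟ u)
      where
      decide : Dec (x ≡ u) → Dec (y ≡ u) → (x == u) ≡ (y == u)
      decide (yes x≡u) (yes y≡u) = trans (==-true x≡u) (sym (==-true y≡u))
      decide (no x≢u) (no y≢u) = trans (==-false x≢u) (sym (==-false y≢u))
      decide (yes x≡u) (no _) =
        let uy = subst (λ a → deleteEdge G u v a y ≡ true) x≡u e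
        in ⊥-elim (deleteEdge-from-u G uy (only-v (deleteEdge-⊆ G uy) y≢m₁ y≢m₂))
      decide (no _) (yes y≡u) =
        let xu = subst (λ b → deleteEdge G u v x b ≡ true) y≡u e
        in ⊥-elim (deleteEdge-into-u G xu (only-v (adjacent-sym sim (deleteEdge-⊆ G xu)) x≢m₁ x≢m₂))

  separation-at-cubic : ∀ {u v} → Cubic G u → G u v ≡ true → Separation G u v
  separation-at-cubic {u} {v} cu uv with Cubic.only cu v uv
  ... | inj₁ refl =
    separation-at-sparse-endpoint uv only (adjacent⇒≢ sim ub) (adjacent⇒≢ sim uc) a≢b a≢c
    where open Cubic cu
  ... | inj₂ (inj₁ refl) =
    separation-at-sparse-endpoint uv (λ y → In3-swap ∘ only y)
      (adjacent⇒≢ sim ua) (adjacent⇒≢ sim uc) (a≢b ∘ sym) b≢c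
    where open Cubic cu
  ... | inj₂ (inj₂ refl) =
    separation-at-sparse-endpoint uv (λ y → In3-rotate ∘ only y)
      (adjacent⇒≢ sim ua) (adjacent⇒≢ sim ub) (a≢c ∘ sym) (b≢c ∘ sym)
    where open Cubic cu

  separable-by-cases : (S : Fin n → Set) → (∀ z → Dec (S z)) → (∀ z → S z → Cubic G z) →
    (∀ x y → ¬ S x → ¬ S y → G x y ≡ true → Separation G x y) → Separable G
  separable-by-cases S S? cubic-on-S rest x y xy with S? x | S? y
  ... | yes x∈S | _ = separation-at-cubic (cubic-on-S x x∈S) xy
  ... | no _ | yes y∈S = separation-flip (separation-at-cubic (cubic-on-S y y∈S) (adjacent-sym sim xy))
  ... | no x∉S | no y∉S = rest x y x∉S y∉S xy

-- Every vertex of K₄ has degree three: its neighbours are the vertices mapped to the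
-- three values of Fin 4 other than its own, obtained by `punchIn`.
K4-cubic : ∀ {n} {G : Graph n} → IsoK4 G → ∀ u → Cubic G u
K4-cubic {n} {G} (f , f-inj , f-surj , adj) u = record
  { a = other zero ; b = other (suc zero) ; c = other (suc (suc zero))
  ; ua = adjacent (other-≢ zero) ; ub = adjacent (other-≢ (suc zero))
  ; uc = adjacent (other-≢ (suc (suc zero)))
  ; a≢b = λ e → 0≢1 (other-injective e) ; a≢c = λ e → 0≢2 (other-injective e)
  ; b≢c = λ e → 1≢2 (other-injective e)
  ; only = only }
  where
  other : Fin 3 → Fin n
  other i = proj₁ (f-surj (punchIn (f u) i))
  f-other : ∀ i → f (other i) ≡ punchIn (f u) i
  f-other i = proj₂ (f-surj (punchIn (f u) i))
  other-≢ : ∀ i → f u ≢ f (other i)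
  other-≢ i e = punchInᵢ≢i (f u) i (trans (sym (f-other i)) (sym e))
  other-injective : ∀ {i k} → other i ≡ other k → i ≡ k
  other-injective {i} {k} e = punchIn-injective (f u) i k (trans (sym (f-other i)) (trans (cong f e) (f-other k)))
  adjacent : ∀ {z} → f u ≢ f z → G u z ≡ true
  adjacent fu≢fz = trans (adj u _) (cong not (==-false fu≢fz))
  0≢1 : zero ≢ suc {2} zero
  0≢1 ()
  0≢2 : zero ≢ suc {2} (suc zero)
  0≢2 ()
  1≢2 : suc zero ≢ suc {2} (suc zero)
  1≢2 ()
  only : ∀ z → G u z ≡ true → In3 (other zero) (other (suc zero)) (other (suc (suc zero))) z
  only z uz = from-index (punchOut fu≢fz) (f-inj z _ (trans (sym (punchIn-punchOut fu≢fz)) (sym (f-other _))))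
    where
    fu≢fz : f u ≢ f z
    fu≢fz e = t≢f (trans (sym uz) (trans (adj u z) (cong not (==-true e))))
    from-index : ∀ i → z ≡ other i → In3 (other zero) (other (suc zero)) (other (suc (suc zero))) z
    from-index zero e = inj₁ e
    from-index (suc zero) e = inj₂ (inj₁ e)
    from-index (suc (suc zero)) e = inj₂ (inj₂ e)

K4-separable : ∀ {n} {G : Graph n} → IsSimple G → IsoK4 G → Separable G
K4-separable sim iso =
  separable-by-cases sim (λ _ → ⊤) (λ _ → yes tt) (λ u _ → K4-cubic iso u) (λ x y x∉ _ _ → ⊥-elim (x∉ tt))

module D3a-lift {n m} {G : Graph n} {H : Graph m} (simG : IsSimple G) (d : D3a G H)
                (sepH : Separable H) where
  open D3a d

  w : Fin m
  w = σ p

  σ-triangle : ∀ {z} → In3 p q r z → σ z ≡ w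
  σ-triangle (inj₁ refl) = refl
  σ-triangle (inj₂ (inj₁ refl)) = σq
  σ-triangle (inj₂ (inj₂ refl)) = σr

  triangle≢outside : ∀ {t z} → In3 p q r t → ¬ In3 p q r z → t ≢ z
  triangle≢outside t∈ z∉ refl = z∉ t∈

  p∈ : In3 p q r p
  p∈ = inj₁ refl
  q∈ : In3 p q r q
  q∈ = inj₂ (inj₁ refl)
  r∈ : In3 p q r r
  r∈ = inj₂ (inj₂ refl)

  σ-separates : ∀ {z g} → ¬ In3 p q r z → z ≢ g → σ z ≢ σ g
  σ-separates {z} {g} z∉ z≢g e with In3? p q r g
  ... | yes g∈ = σ-out z z∉ (trans e (σ-triangle g∈))
  ... | no g∉ = z≢g (σ-inj z g z∉ g∉ e)

  preimage : Fin m → Fin n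
  preimage s = proj₁ (σ-surj s)

  σ-preimage : ∀ {s} → σ (preimage s) ≡ s
  σ-preimage {s} = proj₂ (σ-surj s)

  ≢-preimage : ∀ {z s} → σ z ≢ s → z ≢ preimage s
  ≢-preimage σz≢s refl = σz≢s σ-preimage

  avoids-preimage : ∀ {z s} → ¬ In3 p q r z → z ≢ preimage s → σ z ≢ s
  avoids-preimage z∉ z≢g e = σ-separates z∉ z≢g (trans e (sym σ-preimage))

  cubic-triangle : ∀ z → In3 p q r z → Cubic G z
  cubic-triangle _ (inj₁ refl) =
    cubic G degp pq pr pa q≢r (triangle≢outside q∈ a∉) (triangle≢outside r∈ a∉)
  cubic-triangle _ (inj₂ (inj₁ refl)) =
    cubic G degq (adjacent-sym simG pq) qr qb p≢r (triangle≢outside p∈ b∉) (triangle≢outside r∈ b∉)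
  cubic-triangle _ (inj₂ (inj₂ refl)) =
    cubic G degr (adjacent-sym simG pr) (adjacent-sym simG qr) rc p≢q
      (triangle≢outside p∈ c∉) (triangle≢outside q∈ c∉)

  exits : ∀ {z z'} → In3 p q r z → ¬ In3 p q r z' → G z z' ≡ true →
    (z ≡ p × z' ≡ a) ⊎ (z ≡ q × z' ≡ b) ⊎ (z ≡ r × z' ≡ c)
  exits {z' = z'} z∈@(inj₁ refl) z'∉ e with Cubic.only (cubic-triangle _ z∈) z' e
  ... | inj₁ z'≡q = ⊥-elim (z'∉ (inj₂ (inj₁ z'≡q)))
  ... | inj₂ (inj₁ z'≡r) = ⊥-elim (z'∉ (inj₂ (inj₂ z'≡r)))
  ... | inj₂ (inj₂ z'≡a) = inj₁ (refl , z'≡a)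
  exits {z' = z'} z∈@(inj₂ (inj₁ refl)) z'∉ e with Cubic.only (cubic-triangle _ z∈) z' e
  ... | inj₁ z'≡p = ⊥-elim (z'∉ (inj₁ z'≡p))
  ... | inj₂ (inj₁ z'≡r) = ⊥-elim (z'∉ (inj₂ (inj₂ z'≡r)))
  ... | inj₂ (inj₂ z'≡b) = inj₂ (inj₁ (refl , z'≡b))
  exits {z' = z'} z∈@(inj₂ (inj₂ refl)) z'∉ e with Cubic.only (cubic-triangle _ z∈) z' e
  ... | inj₁ z'≡p = ⊥-elim (z'∉ (inj₁ z'≡p))
  ... | inj₂ (inj₁ z'≡q) = ⊥-elim (z'∉ (inj₂ (inj₁ z'≡q)))
  ... | inj₂ (inj₂ z'≡c) = inj₂ (inj₂ (refl , z'≡c))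

  exit-in-H : ∀ {z z'} → In3 p q r z → ¬ In3 p q r z' → G z z' ≡ true → H w (σ z') ≡ true
  exit-in-H z∈ z'∉ e with exits z∈ z'∉ e
  ... | inj₁ (_ , refl) rewrite adj-new a a∉ | ==-true (refl {x = a}) = refl
  ... | inj₂ (inj₁ (_ , refl)) rewrite adj-new b b∉ | ==-false (a≢b ∘ sym) | ==-true (refl {x = b}) = refl
  ... | inj₂ (inj₂ (_ , refl))
    rewrite adj-new c c∉ | ==-false (a≢c ∘ sym) | ==-false (b≢c ∘ sym) | ==-true (refl {x = c}) = refl

  -- For any colouring κ, two of the three exits a, b, c share a colour val.
  record Majority (κ : Fin n → Bool) : Set where
    field
      t : Fin n
      t∈ : In3 p q r t
      val : Bool
      agrees : ∀ {z z'} → In3 p q r z → z ≢ t → ¬ In3 p q r z' → G z z' ≡ true → val ≡ κ z'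

  majority : ∀ κ → Majority κ
  majority κ = choose (κ a) (κ b) (κ c) refl refl refl
    where
    build : ∀ t → In3 p q r t → ∀ val →
      (p ≢ t → val ≡ κ a) → (q ≢ t → val ≡ κ b) → (r ≢ t → val ≡ κ c) → Majority κ
    build t t∈ val at-a at-b at-c = record { t = t ; t∈ = t∈ ; val = val ; agrees = agrees }
      where
      agrees : ∀ {z z'} → In3 p q r z → z ≢ t → ¬ In3 p q r z' → G z z' ≡ true → val ≡ κ z'
      agrees z∈ z≢t z'∉ e with exits z∈ z'∉ e
      ... | inj₁ (refl , refl) = at-a z≢t
      ... | inj₂ (inj₁ (refl , refl)) = at-b z≢t
      ... | inj₂ (inj₂ (refl , refl)) = at-c z≢t
    absurd : ∀ {z : Fin n} {B : Set} → z ≢ z → B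
    absurd z≢z = ⊥-elim (z≢z refl)
    choose : ∀ A B C → κ a ≡ A → κ b ≡ B → κ c ≡ C → Majority κ
    choose true true _ ea eb _ = build r r∈ true (λ _ → sym ea) (λ _ → sym eb) absurd
    choose false false _ ea eb _ = build r r∈ false (λ _ → sym ea) (λ _ → sym eb) absurd
    choose true false true ea _ ec = build q q∈ true (λ _ → sym ea) absurd (λ _ → sym ec)
    choose false true false ea _ ec = build q q∈ false (λ _ → sym ea) absurd (λ _ → sym ec)
    choose true false false _ eb ec = build p p∈ false absurd (λ _ → sym eb) (λ _ → sym ec)
    choose false true true _ eb ec = build p p∈ true absurd (λ _ → sym eb) (λ _ → sym ec)

  module _ {x y} (x∉ : ¬ In3 p q r x) (y∉ : ¬ In3 p q r y) (xy : G x y ≡ true) where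
    open Separation (sepH (σ x) (σ y) (trans (adj-out x y x∉ y∉) xy))

    lift-deletion : ∀ {z z'} → ¬ In3 p q r z → ¬ In3 p q r z' →
      deleteEdge G x y z z' ≡ true → deleteEdge H (σ x) (σ y) (σ z) (σ z') ≡ true
    lift-deletion z∉ z'∉ e =
      trans (deleteEdge-rename H σ (σ-inj _ _ z∉ x∉) (σ-inj _ _ z'∉ y∉) (σ-inj _ _ z∉ y∉) (σ-inj _ _ z'∉ x∉))
            (deleteEdge-mono G (λ i j → H (σ i) (σ j)) (trans (adj-out _ _ z∉ z'∉)) e)

    -- w is not an endpoint of σx σy, so its edges survive the deletion.
    w-edge-kept : ∀ {s} → H w s ≡ true → deleteEdge H (σ x) (σ y) w s ≡ true
    w-edge-kept {s} e = trans (deleteEdge-away H s (σ-out x x∉ ∘ sym) (σ-out y y∉ ∘ sym)) e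

    -- The separation pulls back to G with separator {g₁, g₂}, colouring the triangle by
    -- val and every other vertex by its image, provided outside vertices off {g₁, g₂}
    -- avoid the separator of H and the exits of surviving triangle vertices have colour val.
    pullback : (g₁ g₂ : Fin n) (val : Bool) → x ≢ g₁ → x ≢ g₂ → y ≢ g₁ → y ≢ g₂ →
      (∀ {z} → ¬ In3 p q r z → z ≢ g₁ → z ≢ g₂ → σ z ≢ α × σ z ≢ β) →
      (∀ {z z'} → In3 p q r z → z ≢ g₁ → z ≢ g₂ → ¬ In3 p q r z' → z' ≢ g₁ → z' ≢ g₂ →
        G z z' ≡ true → val ≡ colour (σ z')) →
      Separation G x y
    pullback g₁ g₂ val x≢g₁ x≢g₂ y≢g₁ y≢g₂ avoids exits-agree = record
      { α = g₁ ; β = g₂ ; colour = colourG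
      ; u≢α = x≢g₁ ; u≢β = x≢g₂ ; v≢α = y≢g₁ ; v≢β = y≢g₂
      ; colour-u = trans (colourG-outside x∉) colour-u
      ; colour-v = trans (colourG-outside y∉) colour-v
      ; respects = respectsG }
      where
      colourG : Fin n → Bool
      colourG z = if does (In3? p q r z) then val else colour (σ z)
      colourG-triangle : ∀ {z} → In3 p q r z → colourG z ≡ val
      colourG-triangle {z} z∈ =
        cong (λ b → if b then val else colour (σ z)) (dec-true (In3? p q r z) z∈)
      colourG-outside : ∀ {z} → ¬ In3 p q r z → colourG z ≡ colour (σ z)
      colourG-outside {z} z∉ =
        cong (λ b → if b then val else colour (σ z)) (dec-false (In3? p q r z) z∉)
      respectsG : ∀ z z' → z ≢ g₁ → z ≢ g₂ → z' ≢ g₁ → z' ≢ g₂ →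
        deleteEdge G x y z z' ≡ true → colourG z ≡ colourG z'
      respectsG z z' z≢g₁ z≢g₂ z'≢g₁ z'≢g₂ e with In3? p q r z | In3? p q r z'
      ... | yes z∈ | yes z'∈ = trans (colourG-triangle z∈) (sym (colourG-triangle z'∈))
      ... | yes z∈ | no z'∉ = trans (colourG-triangle z∈) (trans
              (exits-agree z∈ z≢g₁ z≢g₂ z'∉ z'≢g₁ z'≢g₂ (deleteEdge-⊆ G e))
              (sym (colourG-outside z'∉)))
      ... | no z∉ | yes z'∈ = trans (colourG-outside z∉) (trans
              (sym (exits-agree z'∈ z'≢g₁ z'≢g₂ z∉ z≢g₁ z≢g₂ (adjacent-sym simG (deleteEdge-⊆ G e))))
              (sym (colourG-triangle z'∈)))
      ... | no z∉ | no z'∉ = trans (colourG-outside z∉) (trans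
              (respects (σ z) (σ z') (proj₁ σz-avoids) (proj₂ σz-avoids) (proj₁ σz'-avoids) (proj₂ σz'-avoids)
                (lift-deletion z∉ z'∉ e))
              (sym (colourG-outside z'∉)))
        where
        σz-avoids : σ z ≢ α × σ z ≢ β
        σz-avoids = avoids z∉ z≢g₁ z≢g₂
        σz'-avoids : σ z' ≢ α × σ z' ≢ β
        σz'-avoids = avoids z'∉ z'≢g₁ z'≢g₂

    -- If w is not a separator vertex, take the preimages of α and β and colour the
    -- triangle like w.
    pullback-away-from-w : α ≢ w → β ≢ w → Separation G x y
    pullback-away-from-w α≢w β≢w =
      pullback (preimage α) (preimage β) (colour w)
        (≢-preimage u≢α) (≢-preimage u≢β) (≢-preimage v≢α) (≢-preimage v≢β) avoids exits-agree
      where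
      avoids : ∀ {z} → ¬ In3 p q r z → z ≢ preimage α → z ≢ preimage β → σ z ≢ α × σ z ≢ β
      avoids z∉ z≢gα z≢gβ = avoids-preimage z∉ z≢gα , avoids-preimage z∉ z≢gβ
      exits-agree : ∀ {z z'} → In3 p q r z → z ≢ preimage α → z ≢ preimage β →
        ¬ In3 p q r z' → z' ≢ preimage α → z' ≢ preimage β → G z z' ≡ true → colour w ≡ colour (σ z')
      exits-agree z∈ _ _ z'∉ z'≢gα z'≢gβ e =
        respects w _ (α≢w ∘ sym) (β≢w ∘ sym) (avoids-preimage z'∉ z'≢gα) (avoids-preimage z'∉ z'≢gβ)
          (w-edge-kept (exit-in-H z∈ z'∉ e))

    -- If w is a separator vertex and γ the other one, replace w by the triangle vertex t
    -- whose exit may disagree with the majority colour of the exits.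
    pullback-through-w : ∀ γ → (∀ {s} → s ≢ w → s ≢ γ → s ≢ α × s ≢ β) →
      σ x ≢ γ → σ y ≢ γ → Separation G x y
    pullback-through-w γ others-avoid σx≢γ σy≢γ =
      pullback t (preimage γ) val
        (triangle≢outside t∈ x∉ ∘ sym) (≢-preimage σx≢γ)
        (triangle≢outside t∈ y∉ ∘ sym) (≢-preimage σy≢γ)
        (λ z∉ _ z≢gγ → others-avoid (σ-out _ z∉) (avoids-preimage z∉ z≢gγ))
        (λ z∈ z≢t _ z'∉ _ _ e → agrees z∈ z≢t z'∉ e)
      where open Majority (majority (colour ∘ σ))

    lift-edge : Separation G x y
    lift-edge with α ≟ w | β ≟ w
    ... | yes α≡w | _ =
      pullback-through-w β (λ s≢w s≢β → (λ s≡α → s≢w (trans s≡α α≡w)) , s≢β) u≢β v≢β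
    ... | no _ | yes β≡w =
      pullback-through-w α (λ s≢w s≢α → s≢α , (λ s≡β → s≢w (trans s≡β β≡w))) u≢α v≢α
    ... | no α≢w | no β≢w = pullback-away-from-w α≢w β≢w

  separable : Separable G
  separable = separable-by-cases simG (In3 p q r) (In3? p q r) cubic-triangle
                (λ _ _ x∉ y∉ xy → lift-edge x∉ y∉ xy)

module D3b-lift {n m} {G : Graph n} {H : Graph m} (simG : IsSimple G) (d : D3b G H)
                (sepH : Separable H) where
  open D3b d

  q≢s : q ≢ s
  q≢s = adjacent⇒≢ simG sq ∘ sym
  p≢s : p ≢ s
  p≢s = adjacent⇒≢ simG sp ∘ sym
  r≢s : r ≢ s
  r≢s = adjacent⇒≢ simG sr ∘ sym

  cubic-q : Cubic G q
  cubic-q = cubic G degq (adjacent-sym simG pq) qr (adjacent-sym simG sq) p≢r p≢s r≢s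

  cubic-path : ∀ z → In3 p q r z → Cubic G z
  cubic-path _ (inj₁ refl) = cubic₂ G degp pq (adjacent-sym simG sp) q≢s
  cubic-path _ (inj₂ (inj₁ refl)) = cubic-q
  cubic-path _ (inj₂ (inj₂ refl)) = cubic₂ G degr (adjacent-sym simG qr) (adjacent-sym simG sr) q≢s

  H⊇G : ∀ {i j} → G (σ i) (σ j) ≡ true → H i j ≡ true
  H⊇G {i} {j} e = trans (adj i j) (cong (_∨ _) e)

  preimage : ∀ z → z ≢ q → Fin m
  preimage z z≢q = proj₁ (σ-surj z z≢q)

  σ-preimage : ∀ {z} (z≢q : z ≢ q) → σ (preimage z z≢q) ≡ z
  σ-preimage {z} z≢q = proj₂ (σ-surj z z≢q)

  ip ir is : Fin m
  ip = preimage p p≢q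
  ir = preimage r (q≢r ∘ sym)
  is = preimage s (q≢s ∘ sym)

  σ-ip : σ ip ≡ p
  σ-ip = σ-preimage p≢q
  σ-ir : σ ir ≡ r
  σ-ir = σ-preimage (q≢r ∘ sym)
  σ-is : σ is ≡ s
  σ-is = σ-preimage (q≢s ∘ sym)

  -- ip, ir, is form a triangle in H: ps and rs survive and pr is the new edge.
  H-pr : H ip ir ≡ true
  H-pr rewrite adj ip ir | σ-ip | σ-ir | pr
             | ==-true (refl {x = p}) | ==-true (refl {x = r}) = refl

  H-ps : H ip is ≡ true
  H-ps = H⊇G (subst₂ (λ a b → G a b ≡ true) (sym σ-ip) (sym σ-is)
                     (adjacent-sym simG sp))

  H-rs : H ir is ≡ true
  H-rs = H⊇G (subst₂ (λ a b → G a b ≡ true) (sym σ-ir) (sym σ-is)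
                     (adjacent-sym simG sr))

  ip≢ir : ip ≢ ir
  ip≢ir e = p≢r (trans (sym σ-ip) (trans (cong σ e) σ-ir))
  ip≢is : ip ≢ is
  ip≢is e = p≢s (trans (sym σ-ip) (trans (cong σ e) σ-is))
  ir≢is : ir ≢ is
  ir≢is e = r≢s (trans (sym σ-ir) (trans (cong σ e) σ-is))

  q-or-image : ∀ z → z ≡ q ⊎ ∃ λ i → σ i ≡ z
  q-or-image z with z ≟ q
  ... | yes z≡q = inj₁ z≡q
  ... | no z≢q = inj₂ (σ-surj z z≢q)

  q-neighbour : ∀ {j} → G q (σ j) ≡ true → In3 ip ir is j
  q-neighbour {j} e with Cubic.only cubic-q (σ j) e
  ... | inj₁ σj≡p = inj₁ (σ-inj _ _ (trans σj≡p (sym σ-ip)))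
  ... | inj₂ (inj₁ σj≡r) = inj₂ (inj₁ (σ-inj _ _ (trans σj≡r (sym σ-ir))))
  ... | inj₂ (inj₂ σj≡s) = inj₂ (inj₂ (σ-inj _ _ (trans σj≡s (sym σ-is))))

  -- An edge of G avoiding p, q, r is the image of an edge of H; we pull back its
  -- separation, giving q the colour of a vertex of the triangle ip ir is off the separator.
  module _ {ix iy} (σx∉ : ¬ In3 p q r (σ ix)) (σy∉ : ¬ In3 p q r (σ iy))
           (xy : G (σ ix) (σ iy) ≡ true) where
    open Separation (sepH ix iy (H⊇G xy))

    lower-deletion : ∀ {i j} → deleteEdge G (σ ix) (σ iy) (σ i) (σ j) ≡ true → deleteEdge H ix iy i j ≡ true
    lower-deletion e = deleteEdge-mono (λ a b → G (σ a) (σ b)) H H⊇G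
      (trans (sym (deleteEdge-rename G σ (σ-inj _ _) (σ-inj _ _) (σ-inj _ _) (σ-inj _ _))) e)

    edge-colour : ∀ {i j} → H i j ≡ true → i ≢ ix → i ≢ iy → i ≢ α → i ≢ β → j ≢ α → j ≢ β →
      colour i ≡ colour j
    edge-colour {i} {j} e i≢ix i≢iy i≢α i≢β j≢α j≢β =
      respects i j i≢α i≢β j≢α j≢β (trans (deleteEdge-away H j i≢ix i≢iy) e)

    ip≢ix : ip ≢ ix
    ip≢ix e = σx∉ (inj₁ (trans (cong σ (sym e)) σ-ip))
    ip≢iy : ip ≢ iy
    ip≢iy e = σy∉ (inj₁ (trans (cong σ (sym e)) σ-ip))
    ir≢ix : ir ≢ ix
    ir≢ix e = σx∉ (inj₂ (inj₂ (trans (cong σ (sym e)) σ-ir)))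
    ir≢iy : ir ≢ iy
    ir≢iy e = σy∉ (inj₂ (inj₂ (trans (cong σ (sym e)) σ-ir)))

    monochromatic : ∀ {i j} → In3 ip ir is i → In3 ip ir is j → i ≢ α → i ≢ β → j ≢ α → j ≢ β →
      colour i ≡ colour j
    monochromatic (inj₁ refl) (inj₁ refl) _ _ _ _ = refl
    monochromatic (inj₂ (inj₁ refl)) (inj₂ (inj₁ refl)) _ _ _ _ = refl
    monochromatic (inj₂ (inj₂ refl)) (inj₂ (inj₂ refl)) _ _ _ _ = refl
    monochromatic (inj₁ refl) (inj₂ (inj₁ refl)) = edge-colour H-pr ip≢ix ip≢iy
    monochromatic (inj₁ refl) (inj₂ (inj₂ refl)) = edge-colour H-ps ip≢ix ip≢iy
    monochromatic (inj₂ (inj₁ refl)) (inj₂ (inj₂ refl)) = edge-colour H-rs ir≢ix ir≢iy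
    monochromatic i∈@(inj₂ (inj₁ refl)) j∈@(inj₁ refl) i≢α i≢β j≢α j≢β =
      sym (monochromatic j∈ i∈ j≢α j≢β i≢α i≢β)
    monochromatic i∈@(inj₂ (inj₂ refl)) j∈@(inj₁ refl) i≢α i≢β j≢α j≢β =
      sym (monochromatic j∈ i∈ j≢α j≢β i≢α i≢β)
    monochromatic i∈@(inj₂ (inj₂ refl)) j∈@(inj₂ (inj₁ refl)) i≢α i≢β j≢α j≢β =
      sym (monochromatic j∈ i∈ j≢α j≢β i≢α i≢β)

    i₀-choice : ∃ λ i → In3 ip ir is i × i ≢ α × i ≢ β
    i₀-choice = avoid-two ip≢ir ip≢is ir≢is α β

    i₀ : Fin m
    i₀ = proj₁ i₀-choice

    -- τ is a section of σ that sends q to i₀; the colouring of G is colour ∘ τ.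
    τ : Fin n → Fin m
    τ z with z ≟ q
    ... | yes _ = i₀
    ... | no z≢q = preimage z z≢q

    τ-σ : ∀ i → τ (σ i) ≡ i
    τ-σ i with σ i ≟ q
    ... | yes σi≡q = ⊥-elim (σ≢q i σi≡q)
    ... | no σi≢q = σ-inj _ _ (σ-preimage σi≢q)

    τ-q : τ q ≡ i₀
    τ-q with q ≟ q
    ... | yes _ = refl
    ... | no q≢q = ⊥-elim (q≢q refl)

    q-side : ∀ {j} → G q (σ j) ≡ true → σ j ≢ σ α → σ j ≢ σ β → colour i₀ ≡ colour j
    q-side e σj≢σα σj≢σβ =
      let _ , i₀∈ , i₀≢α , i₀≢β = i₀-choice
      in monochromatic i₀∈ (q-neighbour e) i₀≢α i₀≢β (σj≢σα ∘ cong σ) (σj≢σβ ∘ cong σ)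

    respectsG : ∀ z z' → z ≢ σ α → z ≢ σ β → z' ≢ σ α → z' ≢ σ β →
      deleteEdge G (σ ix) (σ iy) z z' ≡ true → colour (τ z) ≡ colour (τ z')
    respectsG z z' z≢α z≢β z'≢α z'≢β e with q-or-image z | q-or-image z'
    ... | inj₁ refl | inj₁ refl = refl
    ... | inj₂ (i , refl) | inj₂ (j , refl) = trans (cong colour (τ-σ i)) (trans
            (respects i j (z≢α ∘ cong σ) (z≢β ∘ cong σ) (z'≢α ∘ cong σ) (z'≢β ∘ cong σ)
              (lower-deletion e))
            (sym (cong colour (τ-σ j))))
    ... | inj₁ refl | inj₂ (j , refl) = trans (cong colour τ-q) (trans
            (q-side (deleteEdge-⊆ G e) z'≢α z'≢β) (sym (cong colour (τ-σ j))))
    ... | inj₂ (i , refl) | inj₁ refl = trans (cong colour (τ-σ i)) (trans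
            (sym (q-side (adjacent-sym simG (deleteEdge-⊆ G e)) z≢α z≢β)) (sym (cong colour τ-q)))

    lift-edge : Separation G (σ ix) (σ iy)
    lift-edge = record
      { α = σ α ; β = σ β ; colour = colour ∘ τ
      ; u≢α = u≢α ∘ σ-inj _ _ ; u≢β = u≢β ∘ σ-inj _ _
      ; v≢α = v≢α ∘ σ-inj _ _ ; v≢β = v≢β ∘ σ-inj _ _
      ; colour-u = trans (cong colour (τ-σ ix)) colour-u
      ; colour-v = trans (cong colour (τ-σ iy)) colour-v
      ; respects = respectsG }

  separable : Separable G
  separable = separable-by-cases simG (In3 p q r) (In3? p q r) cubic-path outside
    where
    outside : ∀ x y → ¬ In3 p q r x → ¬ In3 p q r y → G x y ≡ true → Separation G x y
    outside x y x∉ y∉ xy with σ-surj x (x∉ ∘ inj₂ ∘ inj₁) | σ-surj y (y∉ ∘ inj₂ ∘ inj₁)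
    ... | _ , refl | _ , refl = lift-edge x∉ y∉ xy

D3-reducible⇒separable : ∀ {n} {G : Graph n} → IsSimple G → D3Reducible G → Separable G
D3-reducible⇒separable sim (done iso) = K4-separable sim iso
D3-reducible⇒separable sim (step simH (stepA d) red) =
  D3a-lift.separable sim d (D3-reducible⇒separable simH red)
D3-reducible⇒separable sim (step simH (stepB d) red) =
  D3b-lift.separable sim d (D3-reducible⇒separable simH red)

theorem8 : ∀ {n} (G : Graph n) → IsSimple G → D3Reducible G →
    ∀ (u v : Fin n) → G u v ≡ true → ¬ VertexConnected 3 (deleteEdge G u v)
theorem8 G sim red u v uv = separation⇒¬3-connected (D3-reducible⇒separable sim red u v uv)
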